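{- Let $H=(V,E)$ be a hypergraph with edge family $(e_i)_{i\in I}$, all hyperedges nonempty. Then $\xi(H;x,y,0,\mathbf{t})=Z(H;x,(y\,t_i)_{i\in I})$ (with the convention $0^0=1$).
   Context: A hypergraph $H=(V,E)$ has finite vertex set $V$ and finite indexed family $E=(e_i)_{i\in I}$ of subsets of $V$ (parallel edges allowed); here all hyperedges are nonempty. For $J\subseteq I$, $H_J=(V,(e_j)_{j\in J})$ is the partial hypergraph and $H\times J$ the edge section hypergraph with vertex set $\bigcup_{j\in J}e_j$ and edges $(e_j)_{j\in J}$. $k(G)$ denotes the number of connected components of a hypergraph $G$ (a hypergraph without vertices has $0$). A pair $(A,B)$ of disjoint subsets of $I$ is vertex disjoint if $e_a\cap e_b=\emptyset$ for all $a\in A,b\in B$. The multivariate hyperedge elimination polynomial is $\xi(H;x,y,z,\mathbf{t})=\sum_{(A,B)}x^{k(H_{A\sqcup B})-k(H\times B)}y^{|A|+|B|-k(H\times B)}z^{k(H\times B)}\prod_{i\in A\sqcup B}t_i$, summed over vertex disjoint pairs. The multivariate Tutte (Potts) polynomial is $Z(H;x,\mathbf{w})=\sum_{J\subseteq I}x^{k(H_J)}\prod_{j\in J}w_j$. -}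

module Defs where

open import Level using (Level)
open import Data.Nat as ℕ using (ℕ; zero; suc; _∸_; _<ᵇ_)
open import Data.Bool using (Bool; true; false; _∧_; _∨_; not; if_then_else_)
open import Data.Fin using (Fin; zero; suc; toℕ)
open import Data.Vec using (Vec; []; _∷_; lookup; replicate; zipWith; tabulate)
open import Data.List as List using (List; []; _∷_; _++_; concatMap; filter; foldr; map)
open import Data.List using (allFin) public
open import Algebra.Bundles using (CommutativeRing)

-- A hypergraph on vertex set V = Fin n with edge family (e i) indexed by I = Fin m:
-- each edge is a subset of Fin n, represented as a characteristic vector.
Edge : ℕ → Set
Edge n = Vec Bool n

IndexSet : ℕ → Set
IndexSet m = Fin m → Bool

∅ᵛ : ∀ {n} → Vec Bool n
∅ᵛ = replicate _ false

_∪ᵛ_ : ∀ {n} → Vec Bool n → Vec Bool n → Vec Bool n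
_∪ᵛ_ = zipWith _∨_

anyᵛ : ∀ {n} → Vec Bool n → Bool
anyᵛ [] = false
anyᵛ (b ∷ bs) = b ∨ anyᵛ bs

meets : ∀ {n} → Vec Bool n → Vec Bool n → Bool
meets S T = anyᵛ (zipWith _∧_ S T)

singletonᵛ : ∀ {n} → Fin n → Vec Bool n
singletonᵛ v = tabulate (λ u → toℕ u ℕ.≡ᵇ toℕ v)

unionᵛ : ∀ {n} → List (Vec Bool n) → Vec Bool n
unionᵛ = foldr _∪ᵛ_ ∅ᵛ

anyL : ∀ {a} {A : Set a} → (A → Bool) → List A → Bool
anyL p = foldr (λ a b → p a ∨ b) false

allL : ∀ {a} {A : Set a} → (A → Bool) → List A → Bool
allL p = foldr (λ a b → p a ∧ b) true

countL : ∀ {a} {A : Set a} → (A → Bool) → List A → ℕ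
countL p = foldr (λ a k → if p a then suc k else k) 0

-- Connected components of a hypergraph (W, F) with vertex set W ⊆ Fin n
-- and edge list F (each edge ⊆ W).

step : ∀ {n} → List (Vec Bool n) → Vec Bool n → Vec Bool n
step F S = S ∪ᵛ unionᵛ (filter (λ e → meets e S Data.Bool.≟ true) F)
  where import Data.Bool

iterate : ∀ {a} {A : Set a} → ℕ → (A → A) → A → A
iterate zero f a = a
iterate (suc k) f a = f (iterate k f a)

-- vertices connected to v by a walk through edges of F
-- (n closure steps suffice since each step adds a vertex or stabilises)
reach : ∀ {n} → List (Vec Bool n) → Fin n → Vec Bool n
reach {n} F v = iterate n (step F) (singletonᵛ v)

-- number of connected components of (W, F): the number of vertices of W
-- that are the least (by index) vertex of their component
k : ∀ {n} → Vec Bool n → List (Vec Bool n) → ℕ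
k {n} W F = countL isLeast (allFin n)
  where
  isLeast : Fin _ → Bool
  isLeast v = lookup W v ∧ not (anyL (λ u → (toℕ u <ᵇ toℕ v) ∧ lookup (reach F v) u) (allFin n))

module _ {n m : ℕ} (e : Fin m → Edge n) where

  edgesOf : IndexSet m → List (Edge n)
  edgesOf J = map e (filter (λ i → J i Data.Bool.≟ true) (allFin m))
    where import Data.Bool

  -- k(H_J): partial hypergraph, vertex set all of V
  kPartial : IndexSet m → ℕ
  kPartial J = k (replicate n true) (edgesOf J)

  -- k(H × J): edge section hypergraph, vertex set ⋃_{j∈J} e_j
  kSection : IndexSet m → ℕ
  kSection J = k (unionᵛ (edgesOf J)) (edgesOf J)

  card : IndexSet m → ℕ
  card J = countL J (allFin m)

  _∪ᴵ_ : IndexSet m → IndexSet m → IndexSet m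
  (A ∪ᴵ B) i = A i ∨ B i

  -- (A , B) vertex disjoint: e_a ∩ e_b = ∅ for all a ∈ A, b ∈ B
  -- (A, B are additionally required to be disjoint index sets; this is
  -- built into the enumeration below)
  vertexDisjoint : IndexSet m → IndexSet m → Bool
  vertexDisjoint A B =
    allL (λ a → allL (λ b → not (A a ∧ B b ∧ meets (e a) (e b))) (allFin m)) (allFin m)

allSubsets : (m : ℕ) → List (IndexSet m)
allSubsets zero = (λ ()) ∷ []
allSubsets (suc m) =
  concatMap (λ J → map (λ b → cons b J) (true ∷ false ∷ [])) (allSubsets m)
  where
  cons : Bool → IndexSet m → IndexSet (suc m)
  cons b J zero = b
  cons b J (suc i) = J i

data Label : Set where
  out inA inB : Label

-- all ordered pairs (A , B) of disjoint subsets of Fin m, as labellings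
allLabellings : (m : ℕ) → List (Fin m → Label)
allLabellings zero = (λ ()) ∷ []
allLabellings (suc m) =
  concatMap (λ f → map (λ l → cons l f) (out ∷ inA ∷ inB ∷ [])) (allLabellings m)
  where
  cons : Label → (Fin m → Label) → Fin (suc m) → Label
  cons l f zero = l
  cons l f (suc i) = f i

isA : Label → Bool
isA inA = true
isA _ = false

isB : Label → Bool
isB inB = true
isB _ = false

module Polys {c ℓ} (R : CommutativeRing c ℓ) where
  open CommutativeRing R

  pow : Carrier → ℕ → Carrier
  pow a zero = 1#
  pow a (suc j) = a * pow a j

  Σ : ∀ {a} {A : Set a} → List A → (A → Carrier) → Carrier
  Σ xs f = foldr (λ a s → f a + s) 0# xs

  prod : ∀ {m} → IndexSet m → (Fin m → Carrier) → Carrier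
  prod {m} J w = foldr (λ i p → (if J i then w i else 1#) * p) 1# (allFin m)

  ξ : ∀ {n m} → (Fin m → Edge n) → Carrier → Carrier → Carrier → (Fin m → Carrier) → Carrier
  ξ {n} {m} e x y z t =
    Σ (filter (λ f → vertexDisjoint e (A f) (B f) Data.Bool.≟ true) (allLabellings m)) term
    where
    import Data.Bool
    A B : (Fin m → Label) → IndexSet m
    A f i = isA (f i)
    B f i = isB (f i)
    term : (Fin m → Label) → Carrier
    term f =
      let AB = _∪ᴵ_ e (A f) (B f)
          kB = kSection e (B f)
      in pow x (kPartial e AB ∸ kB)
       * pow y ((card e (A f) ℕ.+ card e (B f)) ∸ kB)
       * pow z kB
       * prod AB t

  Z : ∀ {n m} → (Fin m → Edge n) → Carrier → (Fin m → Carrier) → Carrier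
  Z {n} {m} e x w = Σ (allSubsets m) (λ J → pow x (kPartial e J) * prod J w)

-- At z = 0 every pair (A, B) with B ≠ ∅ contributes 0: since hyperedges are nonempty, the edge
-- section H × B has at least one component, so its term carries the factor 0^{k(H × B)} = 0.
-- The surviving pairs (A, ∅) are all subsets A ⊆ I (trivially vertex disjoint), and each contributes
-- x^{k(H_A)} y^{|A|} ∏_{i ∈ A} t_i = x^{k(H_A)} ∏_{i ∈ A} (y t_i), the term of Z for J = A.
module Submission where

open import Defs
open import Algebra.Bundles using (CommutativeRing)
import Algebra.Properties.CommutativeSemigroup as CommutativeSemigroupProperties
open import Data.Bool using (Bool; true; false; _∧_; _∨_; not; if_then_else_; T; _≟_)
open import Data.Empty using (⊥-elim)
open import Data.Fin using (Fin; zero; suc; toℕ)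
open import Data.Fin.Properties using (toℕ-injective)
open import Data.Fin.Subset using (Subset; _∈_; _⊆_; _∪_; ⋃; Nonempty)
open import Data.Fin.Subset.Properties using (p⊆p∪q; q⊆p∪q; x∈p∪q⁻; ∉⊥)
open import Data.List using (List; []; _∷_; _++_; concatMap; filter; foldr; map)
open import Data.List.Membership.Propositional using () renaming (_∈_ to _∈ₗ_)
open import Data.List.Membership.Propositional.Properties using (∈-allFin; ∈-filter⁺; ∈-filter⁻; ∈-map⁺)
open import Data.List.Properties using (foldr-cong; filter-≐; filter-none)
open import Data.List.Relation.Unary.All using (universal)
open import Data.List.Relation.Unary.Any using (here; there)
open import Data.Nat as ℕ using (ℕ; zero; suc; _∸_; _<_; _<ᵇ_; s<s)
open import Data.Nat.Properties using (≡ᵇ⇒≡; <ᵇ⇒<)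
import Data.Nat.Properties as ℕₚ
open import Data.Product using (∃; _×_; _,_; proj₁)
open import Data.Sum using (inj₁; inj₂)
open import Data.Unit using (tt)
open import Data.Vec using (lookup; replicate)
open import Data.Vec.Functional using () renaming (_∷_ to _◂_)
open import Data.Vec.Properties using ([]=⇒lookup; lookup⇒[]=; lookup∘tabulate; lookup-replicate)
open import Function using (_∘_)
open import Relation.Binary.PropositionalEquality
  using (_≡_; _≗_; refl; sym; trans; cong; cong₂; subst)
import Relation.Binary.Reasoning.Setoid as SetoidReasoning

countL-false : ∀ {a} {A : Set a} {p : A → Bool} → (∀ x → p x ≡ false) → ∀ xs → countL p xs ≡ 0
countL-false p≡false []       = refl
countL-false p≡false (x ∷ xs) rewrite p≡false x = countL-false p≡false xs

countL-nonzero : ∀ {a} {A : Set a} {p : A → Bool} {v} xs → v ∈ₗ xs → p v ≡ true →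
                 ∃ λ j → countL p xs ≡ suc j
countL-nonzero (x ∷ xs) (here refl) pv rewrite pv = _ , refl
countL-nonzero {p = p} (x ∷ xs) (there v∈xs) pv with p x
... | true  = _ , refl
... | false = countL-nonzero xs v∈xs pv

anyL-false : ∀ {a} {A : Set a} {p : A → Bool} → (∀ x → p x ≡ false) → ∀ xs → anyL p xs ≡ false
anyL-false p≡false []       = refl
anyL-false p≡false (x ∷ xs) rewrite p≡false x = anyL-false p≡false xs

allL-true : ∀ {a} {A : Set a} {p : A → Bool} → (∀ x → p x ≡ true) → ∀ xs → allL p xs ≡ true
allL-true p≡true []       = refl
allL-true p≡true (x ∷ xs) rewrite p≡true x = allL-true p≡true xs

countL-cong : ∀ {a} {A : Set a} {p q : A → Bool} → p ≗ q → countL p ≗ countL q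
countL-cong p≗q = foldr-cong (λ x c → cong (λ b → if b then suc c else c) (p≗q x)) refl

allL-cong : ∀ {a} {A : Set a} {p q : A → Bool} → p ≗ q → allL p ≗ allL q
allL-cong p≗q = foldr-cong (λ x r → cong (_∧ r) (p≗q x)) refl

iterate-preserves : ∀ {a p} {A : Set a} (P : A → Set p) {f : A → A} →
                    (∀ {a} → P a → P (f a)) → ∀ j {a} → P a → P (iterate j f a)
iterate-preserves P f-pres zero    Pa = Pa
iterate-preserves P f-pres (suc j) Pa = f-pres (iterate-preserves P f-pres j Pa)

least-witness : ∀ {n} (P : Fin n → Bool) {w} → P w ≡ true →
                ∃ λ v → P v ≡ true × (∀ u → toℕ u < toℕ v → P u ≡ false)
least-witness {suc n} P {w} Pw with P zero in P0
... | true = zero , P0 , λ _ ()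
least-witness {suc n} P {zero}  Pw | false with trans (sym P0) Pw
... | ()
least-witness {suc n} P {suc w} Pw | false with least-witness (P ∘ suc) Pw
... | v , Pv , below-false = suc v , Pv , below-suc-false
  where
  below-suc-false : ∀ u → toℕ u < toℕ (suc v) → P u ≡ false
  below-suc-false zero    _       = P0
  below-suc-false (suc u) (s<s u<v) = below-false u u<v

∪-least : ∀ {n} {p q r : Subset n} → p ⊆ r → q ⊆ r → p ∪ q ⊆ r
∪-least {p = p} {q} p⊆r q⊆r x∈p∪q with x∈p∪q⁻ p q x∈p∪q
... | inj₁ x∈p = p⊆r x∈p
... | inj₂ x∈q = q⊆r x∈q

⋃-least : ∀ {n} {q : Subset n} (ps : List (Subset n)) → (∀ {p} → p ∈ₗ ps → p ⊆ q) → ⋃ ps ⊆ q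
⋃-least []       ps⊆q x∈⊥ = ⊥-elim (∉⊥ x∈⊥)
⋃-least (p ∷ ps) ps⊆q = ∪-least (ps⊆q (here refl)) (⋃-least ps (ps⊆q ∘ there))

⊆-⋃ : ∀ {n} {p : Subset n} (ps : List (Subset n)) → p ∈ₗ ps → p ⊆ ⋃ ps
⊆-⋃ (p ∷ ps) (here refl) = p⊆p∪q (⋃ ps)
⊆-⋃ (q ∷ ps) (there p∈ps) = q⊆p∪q q (⋃ ps) ∘ ⊆-⋃ ps p∈ps

singletonᵛ-⊆ : ∀ {n} {W : Subset n} {v} → v ∈ W → singletonᵛ v ⊆ W
singletonᵛ-⊆ {v = v} v∈W {u} u∈⁅v⁆ with toℕ-injective (≡ᵇ⇒≡ (toℕ u) (toℕ v) u≡ᵇv)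
  where
  u≡ᵇv : T (toℕ u ℕ.≡ᵇ toℕ v)
  u≡ᵇv = subst T (sym (trans (sym (lookup∘tabulate _ u)) ([]=⇒lookup u∈⁅v⁆))) tt
... | refl = v∈W

module _ {n} {F : List (Subset n)} {W : Subset n} (F⊆W : ∀ {f} → f ∈ₗ F → f ⊆ W) where

  step-⊆ : ∀ {S} → S ⊆ W → step F S ⊆ W
  step-⊆ S⊆W = ∪-least S⊆W (⋃-least _ (λ f∈ → F⊆W (proj₁ (∈-filter⁻ _ f∈))))

  reach-⊆ : ∀ {v} → v ∈ W → reach F v ⊆ W
  reach-⊆ v∈W = iterate-preserves (_⊆ W) step-⊆ n (singletonᵛ-⊆ v∈W)

  -- The least vertex of W is the least vertex of its own component.
  k-nonzero : Nonempty W → ∃ λ j → k W F ≡ suc j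
  k-nonzero (w , w∈W) with least-witness (lookup W) ([]=⇒lookup w∈W)
  ... | v , Wv , below-v = countL-nonzero (allFin n) (∈-allFin v) isLeast-v
    where
    nothing-below : ∀ u → ((toℕ u <ᵇ toℕ v) ∧ lookup (reach F v) u) ≡ false
    nothing-below u with toℕ u <ᵇ toℕ v in u<ᵇv | lookup (reach F v) u in u∈reach
    ... | false | _    = refl
    ... | true  | false = refl
    ... | true  | true
      with trans (sym (below-v u (<ᵇ⇒< (toℕ u) (toℕ v) (subst T (sym u<ᵇv) tt))))
                 ([]=⇒lookup (reach-⊆ (lookup⇒[]= v W Wv) (lookup⇒[]= u _ u∈reach)))
    ... | ()
    isLeast-v : (lookup W v ∧ not (anyL (λ u → (toℕ u <ᵇ toℕ v) ∧ lookup (reach F v) u) (allFin n))) ≡ true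
    isLeast-v rewrite Wv | anyL-false nothing-below (allFin n) = refl

k-∅ᵛ : ∀ {n} (F : List (Subset n)) → k ∅ᵛ F ≡ 0
k-∅ᵛ {n} F = countL-false (λ v → false-∧ _ (lookup-replicate v false)) (allFin n)
  where
  false-∧ : ∀ {a} b → a ≡ false → a ∧ b ≡ false
  false-∧ _ refl = refl

∅ᴵ : ∀ {m} → IndexSet m
∅ᴵ _ = false

module _ {n m : ℕ} (e : Fin m → Edge n) where

  edgesOf-cong : ∀ {J J'} → J ≗ J' → edgesOf e J ≡ edgesOf e J'
  edgesOf-cong J≗J' = cong (map e) (filter-≐ _ _ (subst (_≡ true) (J≗J' _) , subst (_≡ true) (sym (J≗J' _))) (allFin m))

  kPartial-cong : ∀ {J J'} → J ≗ J' → kPartial e J ≡ kPartial e J'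
  kPartial-cong = cong (k (replicate n true)) ∘ edgesOf-cong

  kSection-cong : ∀ {J J'} → J ≗ J' → kSection e J ≡ kSection e J'
  kSection-cong = cong (λ F → k (unionᵛ F) F) ∘ edgesOf-cong

  card-cong : ∀ {J J'} → J ≗ J' → card e J ≡ card e J'
  card-cong J≗J' = countL-cong J≗J' (allFin m)

  ∪ᴵ-cong : ∀ {A A' B B'} → A ≗ A' → B ≗ B' → _∪ᴵ_ e A B ≗ _∪ᴵ_ e A' B'
  ∪ᴵ-cong A≗A' B≗B' i = cong₂ _∨_ (A≗A' i) (B≗B' i)

  vertexDisjoint-cong : ∀ {A A' B B'} → A ≗ A' → B ≗ B' → vertexDisjoint e A B ≡ vertexDisjoint e A' B'
  vertexDisjoint-cong A≗A' B≗B' = allL-cong (λ a → allL-cong (λ b →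
    cong₂ (λ α β → not (α ∧ β ∧ meets (e a) (e b))) (A≗A' a) (B≗B' b)) (allFin m)) (allFin m)

  kSection-∅ᴵ : kSection e ∅ᴵ ≡ 0
  kSection-∅ᴵ rewrite filter-none (λ i → ∅ᴵ i ≟ true) (universal (λ _ ()) (allFin m)) = k-∅ᵛ {n} []

  card-∅ᴵ : card e ∅ᴵ ≡ 0
  card-∅ᴵ = countL-false (λ _ → refl) (allFin m)

  vertexDisjoint-∅ᴵ : ∀ A → vertexDisjoint e A ∅ᴵ ≡ true
  vertexDisjoint-∅ᴵ A = allL-true (λ a → allL-true (λ b → not-∧-false (A a) {meets (e a) (e b)}) (allFin m)) (allFin m)
    where
    not-∧-false : ∀ α {β} → not (α ∧ false ∧ β) ≡ true
    not-∧-false true  = refl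
    not-∧-false false = refl

  ∪ᴵ-∅ᴵ : ∀ A → _∪ᴵ_ e A ∅ᴵ ≗ A
  ∪ᴵ-∅ᴵ A i with A i
  ... | true  = refl
  ... | false = refl

  kSection-nonzero : ∀ {B i} → B i ≡ true → Nonempty (e i) → ∃ λ j → kSection e B ≡ suc j
  kSection-nonzero {B} {i} Bi (w , w∈eᵢ) =
    k-nonzero (⊆-⋃ (edgesOf e B)) (w , ⊆-⋃ (edgesOf e B) eᵢ∈edges {w} w∈eᵢ)
    where
    eᵢ∈edges : e i ∈ₗ edgesOf e B
    eᵢ∈edges = ∈-map⁺ e (∈-filter⁺ (λ i → B i ≟ true) (∈-allFin i) Bi)

◂-cong : ∀ {a} {A : Set a} {m} (l : A) {f f' : Fin m → A} → f ≗ f' → (l ◂ f) ≗ (l ◂ f')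
◂-cong l f≗f' zero    = refl
◂-cong l f≗f' (suc i) = f≗f' i

subsetLabelling : ∀ {m} → IndexSet m → Fin m → Label
subsetLabelling J i = if J i then inA else out

subsetLabelling-cong : ∀ {m} {J J' : IndexSet m} → J ≗ J' → subsetLabelling J ≗ subsetLabelling J'
subsetLabelling-cong J≗J' i = cong (if_then inA else out) (J≗J' i)

isA∘subsetLabelling : ∀ {m} (J : IndexSet m) → isA ∘ subsetLabelling J ≗ J
isA∘subsetLabelling J i with J i
... | true  = refl
... | false = refl

isB∘subsetLabelling : ∀ {m} (J : IndexSet m) → isB ∘ subsetLabelling J ≗ ∅ᴵ
isB∘subsetLabelling J i with J i
... | true  = refl
... | false = refl

module Summation {c ℓ} (R : CommutativeRing c ℓ) where
  open CommutativeRing R renaming (refl to ≈-refl; sym to ≈-sym; trans to ≈-trans) hiding (zero)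
  open Polys R
  open SetoidReasoning setoid
  open CommutativeSemigroupProperties +-commutativeSemigroup using (x∙yz≈y∙xz)
  open CommutativeSemigroupProperties *-commutativeSemigroup using (interchange)

  Σ-cong : ∀ {a} {A : Set a} (xs : List A) {f g : A → Carrier} → (∀ x → f x ≈ g x) → Σ xs f ≈ Σ xs g
  Σ-cong []       f≈g = ≈-refl
  Σ-cong (x ∷ xs) f≈g = +-cong (f≈g x) (Σ-cong xs f≈g)

  Σ-++ : ∀ {a} {A : Set a} (xs ys : List A) (f : A → Carrier) → Σ (xs ++ ys) f ≈ Σ xs f + Σ ys f
  Σ-++ []       ys f = ≈-sym (+-identityˡ _)
  Σ-++ (x ∷ xs) ys f = ≈-trans (+-congˡ (Σ-++ xs ys f)) (≈-sym (+-assoc _ _ _))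

  Σ-concatMap : ∀ {a b} {A : Set a} {B : Set b} (G : A → List B) (xs : List A) (f : B → Carrier) →
                Σ (concatMap G xs) f ≈ Σ xs (λ x → Σ (G x) f)
  Σ-concatMap G []       f = ≈-refl
  Σ-concatMap G (x ∷ xs) f = ≈-trans (Σ-++ (G x) _ f) (+-congˡ (Σ-concatMap G xs f))

  Σ-filter : ∀ {a} {A : Set a} (P : A → Bool) (xs : List A) (f : A → Carrier) →
             Σ (filter (λ x → P x ≟ true) xs) f ≈ Σ xs (λ x → if P x then f x else 0#)
  Σ-filter P []       f = ≈-refl
  Σ-filter P (x ∷ xs) f with P x
  ... | true  = +-congˡ (Σ-filter P xs f)
  ... | false = ≈-trans (Σ-filter P xs f) (≈-sym (+-identityˡ _))

  -- The enumerations in Defs prepend with a local function that agrees with _◂_ only pointwise.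
  Respects≗ : ∀ {a} {A : Set a} {m} → ((Fin m → A) → Carrier) → Set _
  Respects≗ g = ∀ {f f'} → f ≗ f' → g f ≈ g f'

  Σ-allLabellings-suc : ∀ {m} {g : (Fin (suc m) → Label) → Carrier} → Respects≗ g →
    Σ (allLabellings (suc m)) g ≈ Σ (allLabellings m) (λ f → g (out ◂ f) + (g (inA ◂ f) + (g (inB ◂ f) + 0#)))
  Σ-allLabellings-suc {m} {g} g-resp = ≈-trans (Σ-concatMap _ (allLabellings m) g) (Σ-cong (allLabellings m)
    (λ f → +-cong (g-resp (λ { zero → refl ; (suc _) → refl }))
             (+-cong (g-resp (λ { zero → refl ; (suc _) → refl }))
               (+-congʳ (g-resp (λ { zero → refl ; (suc _) → refl }))))))

  Σ-allSubsets-suc : ∀ {m} {h : IndexSet (suc m) → Carrier} → Respects≗ h →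
    Σ (allSubsets (suc m)) h ≈ Σ (allSubsets m) (λ J → h (true ◂ J) + (h (false ◂ J) + 0#))
  Σ-allSubsets-suc {m} {h} h-resp = ≈-trans (Σ-concatMap _ (allSubsets m) h) (Σ-cong (allSubsets m)
    (λ J → +-cong (h-resp (λ { zero → refl ; (suc _) → refl }))
             (+-congʳ (h-resp (λ { zero → refl ; (suc _) → refl })))))

  Σ-allLabellings-without-inB : ∀ m {g : (Fin m → Label) → Carrier} → Respects≗ g →
    (∀ {f} i → f i ≡ inB → g f ≈ 0#) →
    Σ (allLabellings m) g ≈ Σ (allSubsets m) (g ∘ subsetLabelling)
  Σ-allLabellings-without-inB zero    g-resp g-inB = +-congʳ (g-resp (λ ()))
  Σ-allLabellings-without-inB (suc m) {g} g-resp g-inB = begin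
    Σ (allLabellings (suc m)) g
      ≈⟨ Σ-allLabellings-suc g-resp ⟩
    Σ (allLabellings m) (λ f → g (out ◂ f) + (g (inA ◂ f) + (g (inB ◂ f) + 0#)))
      ≈⟨ Σ-cong (allLabellings m) (λ f → ≈-trans (+-congˡ (+-congˡ (inB-vanishes f))) (x∙yz≈y∙xz _ _ _)) ⟩
    Σ (allLabellings m) g'
      ≈⟨ Σ-allLabellings-without-inB m g'-resp g'-inB ⟩
    Σ (allSubsets m) (g' ∘ subsetLabelling)
      ≈⟨ Σ-cong (allSubsets m) (λ J → +-cong (g-resp (λ { zero → refl ; (suc _) → refl }))
                                             (+-congʳ (g-resp (λ { zero → refl ; (suc _) → refl })))) ⟩
    Σ (allSubsets m) (λ J → g (subsetLabelling (true ◂ J)) + (g (subsetLabelling (false ◂ J)) + 0#))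
      ≈⟨ Σ-allSubsets-suc (g-resp ∘ subsetLabelling-cong) ⟨
    Σ (allSubsets (suc m)) (g ∘ subsetLabelling) ∎
    where
    g' : (Fin m → Label) → Carrier
    g' f = g (inA ◂ f) + (g (out ◂ f) + 0#)
    inB-vanishes : ∀ f → g (inB ◂ f) + 0# ≈ 0#
    inB-vanishes f = ≈-trans (+-identityʳ _) (g-inB zero refl)
    g'-resp : Respects≗ g'
    g'-resp f≗f' = +-cong (g-resp (◂-cong inA f≗f')) (+-congʳ (g-resp (◂-cong out f≗f')))
    g'-inB : ∀ {f} i → f i ≡ inB → g' f ≈ 0#
    g'-inB i fi≡inB = ≈-trans (+-cong (g-inB (suc i) fi≡inB) (≈-trans (+-identityʳ _) (g-inB (suc i) fi≡inB)))
                              (+-identityʳ 0#)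

  prod-cong : ∀ {m} {J J' : IndexSet m} (w : Fin m → Carrier) → J ≗ J' → prod J w ≡ prod J' w
  prod-cong {m} w J≗J' = foldr-cong (λ i p → cong (λ b → (if b then w i else 1#) * p) (J≗J' i)) refl (allFin m)

  pow-countL-*-prod : ∀ {m} y (w : Fin m → Carrier) (J : IndexSet m) xs →
    pow y (countL J xs) * foldr (λ i p → (if J i then w i else 1#) * p) 1# xs
      ≈ foldr (λ i p → (if J i then y * w i else 1#) * p) 1# xs
  pow-countL-*-prod y w J []       = *-identityˡ _
  pow-countL-*-prod y w J (i ∷ xs) with J i
  ... | true  = ≈-trans (interchange _ _ _ _) (*-congˡ (pow-countL-*-prod y w J xs))
  ... | false = ≈-trans (*-congˡ (*-identityˡ _)) (≈-trans (pow-countL-*-prod y w J xs) (≈-sym (*-identityˡ _)))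

  pow-≈0# : ∀ {z ks j} → z ≈ 0# → ks ≡ suc j → pow z ks ≈ 0#
  pow-≈0# z≈0 refl = ≈-trans (*-congʳ z≈0) (zeroˡ _)

  module _ {n m} (e : Fin m → Edge n) (x y z : Carrier) (t : Fin m → Carrier) where

    ξ-term : IndexSet m → IndexSet m → Carrier
    ξ-term A B = pow x (kPartial e (_∪ᴵ_ e A B) ∸ kSection e B)
               * pow y ((card e A ℕ.+ card e B) ∸ kSection e B)
               * pow z (kSection e B)
               * prod (_∪ᴵ_ e A B) t

    ξ-summand : IndexSet m → IndexSet m → Carrier
    ξ-summand A B = if vertexDisjoint e A B then ξ-term A B else 0#

    ξ≈Σ-summands : ξ e x y z t ≈ Σ (allLabellings m) (λ f → ξ-summand (isA ∘ f) (isB ∘ f))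
    ξ≈Σ-summands = Σ-filter (λ f → vertexDisjoint e (isA ∘ f) (isB ∘ f)) (allLabellings m) _

    ξ-summand-cong : ∀ {A A' B B'} → A ≗ A' → B ≗ B' → ξ-summand A B ≡ ξ-summand A' B'
    ξ-summand-cong A≗A' B≗B'
      rewrite vertexDisjoint-cong e A≗A' B≗B' | kPartial-cong e (∪ᴵ-cong e A≗A' B≗B')
            | kSection-cong e B≗B' | card-cong e A≗A' | card-cong e B≗B' | prod-cong t (∪ᴵ-cong e A≗A' B≗B')
      = refl

    ξ-summand-vanishes : ∀ {A B i} → z ≈ 0# → B i ≡ true → Nonempty (e i) → ξ-summand A B ≈ 0#
    ξ-summand-vanishes {A} {B} z≈0 Bi eᵢ≠∅ with kSection-nonzero e Bi eᵢ≠∅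
    ... | j , kB≡1+j with vertexDisjoint e A B
    ...   | false = ≈-refl
    ...   | true  = ≈-trans (*-congʳ (≈-trans (*-congˡ (pow-≈0# z≈0 kB≡1+j)) (zeroʳ _))) (zeroˡ _)

    ξ-summand-∅ᴵ : ∀ A → ξ-summand A ∅ᴵ ≈ pow x (kPartial e A) * prod A (λ i → y * t i)
    ξ-summand-∅ᴵ A
      rewrite vertexDisjoint-∅ᴵ e A | kSection-∅ᴵ e | card-∅ᴵ e | ℕₚ.+-identityʳ (card e A)
            | kPartial-cong e (∪ᴵ-∅ᴵ e A) | prod-cong t (∪ᴵ-∅ᴵ e A)
      = ≈-trans (*-congʳ (*-identityʳ _)) (≈-trans (*-assoc _ _ _) (*-congˡ (pow-countL-*-prod y t A (allFin m))))

mainTheorem6 : ∀ {c ℓ} (R : CommutativeRing c ℓ) (n m : ℕ) (e : Fin m → Edge n)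
    → (∀ i → Nonempty (e i))
    → (x y : CommutativeRing.Carrier R) (t : Fin m → CommutativeRing.Carrier R)
    → CommutativeRing._≈_ R
        (Polys.ξ R e x y (CommutativeRing.0# R) t)
        (Polys.Z R e x (λ i → CommutativeRing._*_ R y (t i)))
mainTheorem6 R n m e edges-nonempty x y t = begin
    ξ e x y 0# t
      ≈⟨ ξ≈Σ-summands e x y 0# t ⟩
    Σ (allLabellings m) (λ f → summand (isA ∘ f) (isB ∘ f))
      ≈⟨ Σ-allLabellings-without-inB m
           (λ f≗f' → reflexive (ξ-summand-cong e x y 0# t (cong isA ∘ f≗f') (cong isB ∘ f≗f')))
           (λ i fᵢ≡inB → ξ-summand-vanishes e x y 0# t ≈-refl (cong isB fᵢ≡inB) (edges-nonempty i)) ⟩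
    Σ (allSubsets m) (λ J → summand (isA ∘ subsetLabelling J) (isB ∘ subsetLabelling J))
      ≈⟨ Σ-cong (allSubsets m) (λ J → ≈-trans
           (reflexive (ξ-summand-cong e x y 0# t (isA∘subsetLabelling J) (isB∘subsetLabelling J)))
           (ξ-summand-∅ᴵ e x y 0# t J)) ⟩
    Z e x (λ i → y * t i) ∎
  where
  open CommutativeRing R renaming (refl to ≈-refl; trans to ≈-trans)
  open Polys R
  open Summation R
  open SetoidReasoning setoid
  summand : IndexSet m → IndexSet m → Carrier
  summand = ξ-summand e x y 0# t
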